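{- For every nonnegative integer $n$, $\log(m_{n,2}+1)\leq (n+1)\log(n+1)$.
   Context: A matroid is a pair $(E,\mathcal{B})$ where $E$ is a finite set and $\mathcal{B}$ is a nonempty collection of subsets of $E$ satisfying the base exchange axiom: for all $B,B'\in\mathcal{B}$ and all $e\in B\setminus B'$ there exists $f\in B'\setminus B$ such that $(B\setminus\{e\})\cup\{f\}\in\mathcal{B}$. All members of $\mathcal{B}$ have the same cardinality $r$, the rank of the matroid. $m_{n,2}$ denotes the number of matroids of rank $2$ on the ground set $[n]=\{1,\dots,n\}$. $\log$ denotes the logarithm to base $2$. -}

module Defs where

open import Data.Bool using (Bool; true; false; _∧_; _∨_; not; if_then_else_)
open import Data.Nat using (ℕ; zero; suc; _≡ᵇ_)
open import Data.Product using (_×_; _,_)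
open import Data.List using (List; []; _∷_; _++_; map; length; filterᵇ; cartesianProduct)
open import Data.Bool.ListAction using (all; any)
open import Data.Vec using (Vec; []; _∷_; lookup; _[_]≔_)
open import Data.Fin using (Fin)
open import Data.Fin.Subset using (Subset; ∣_∣)
open import Data.List using () renaming (allFin to allFinL)

-- Families of subsets of [n] = Fin n, i.e. elements of P(P([n])).
-- Encoded as a binary decision tree over the membership of the
-- first element: Family (suc n) = (members not containing 0 ,
-- members containing 0).  Propositional equality on Family n is
-- exactly equality of families.
Family : ℕ → Set
Family zero    = Bool
Family (suc n) = Family n × Family n

mem : ∀ {n} → Family n → Subset n → Bool
mem {zero}  b        []          = b
mem {suc n} (F₀ , F₁) (false ∷ S) = mem F₀ S
mem {suc n} (F₀ , F₁) (true ∷ S)  = mem F₁ S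

allSubsets : ∀ n → List (Subset n)
allSubsets zero    = [] ∷ []
allSubsets (suc n) = map (false ∷_) (allSubsets n) ++ map (true ∷_) (allSubsets n)

allFamilies : ∀ n → List (Family n)
allFamilies zero    = false ∷ true ∷ []
allFamilies (suc n) = cartesianProduct (allFamilies n) (allFamilies n)

baseExchange : ∀ {n} → Family n → Bool
baseExchange {n} F =
  all (λ B → not (mem F B) ∨
    all (λ B' → not (mem F B') ∨
      all (λ e → not (lookup B e ∧ not (lookup B' e)) ∨
        any (λ f → lookup B' f ∧ not (lookup B f) ∧
                   mem F ((B [ e ]≔ false) [ f ]≔ true))
            (allFinL n))
        (allFinL n))
      (allSubsets n))
    (allSubsets n)

isRank2Matroid : ∀ {n} → Family n → Bool
isRank2Matroid {n} F =
  any (mem F) (allSubsets n) ∧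
  baseExchange F ∧
  all (λ B → not (mem F B) ∨ (∣ B ∣ ≡ᵇ 2)) (allSubsets n)

m₂ : ℕ → ℕ
m₂ n = length (filterᵇ isRank2Matroid (allFamilies n))

{-# OPTIONS --safe #-}
module Submission where

-- A rank-2 matroid is determined by its parallel classes.  Call a non-loop
-- an element lying in some base; two non-loops a ≠ b form a base exactly
-- when they are not parallel, and parallelism is transitive: if {x, y} is a
-- base and z is a non-loop in a base {z, l}, exchanging l for an element f
-- of {x, y} yields a base {z, f}, so z is not parallel to both x and y.
-- Hence labelling every element by the least element of its parallel class
-- (nothing for a loop) is injective on rank-2 matroids on [n].  There are
-- (n+1)^n labellings, so m_{n,2} ≤ (n+1)^n and m_{n,2} + 1 ≤ (n+1)^(n+1).

open import Defs
open import Data.Nat using (ℕ; zero; suc; _+_; _*_; _^_; _≤_; z≤n; s≤s; _≡ᵇ_)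
open import Data.Bool using (Bool; true; false; T; not; _∧_; _∨_)
open import Data.Bool.Properties using (T-∧; T-≡)
open import Data.Bool.ListAction using (all; any)
open import Data.Empty using (⊥-elim)
open import Data.Fin using (Fin; zero; suc; _≟_; funToFin; finToFun)
open import Data.Fin.Properties using (any?; pigeonhole; <⇒≢; finToFun-funToFin)
open import Data.Fin.Subset using (Subset; ⊥; ∣_∣)
open import Data.Fin.Subset.Properties using (∣⊥∣≡0)
open import Data.List using (List; length; lookup; filter; allFin)
open import Data.List.Membership.Propositional using (_∈_)
open import Data.List.Membership.Propositional.Properties
  using (∈-map⁺; ∈-++⁺ˡ; ∈-++⁺ʳ; ∈-allFin; ∈-lookup; ∈-filter⁻)
open import Data.List.Relation.Unary.All as All using ([]; _∷_)
open import Data.List.Relation.Unary.All.Properties using (all⁺)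
open import Data.List.Relation.Unary.Any using (here; satisfied)
open import Data.List.Relation.Unary.Any.Properties using (any⁻)
open import Data.List.Relation.Unary.AllPairs using ([]; _∷_)
open import Data.List.Relation.Unary.Unique.Propositional using (Unique)
open import Data.List.Relation.Unary.Unique.Propositional.Properties using (cartesianProduct⁺; filter⁺)
open import Data.Maybe using (Maybe; just; nothing; maybe)
import Data.Maybe as Maybe
open import Data.Nat.Properties using (≡ᵇ⇒≡; suc-injective; ≮⇒≥; ≤-trans; +-monoˡ-≤; +-monoʳ-≤; m^n>0; m≤n*m; module ≤-Reasoning)
open import Data.Product using (_×_; _,_; proj₁; proj₂; ∃; ∃₂)
import Data.Product as Product
open import Data.Sum using (_⊎_; inj₁; inj₂)
open import Data.Vec using ([]; _∷_; _[_]≔_)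
import Data.Vec as Vec
open import Data.Vec.Properties using (lookup∘update; lookup∘update′; lookup-replicate; []≔-idempotent; []≔-commutes; []≔-lookup)
open import Function using (_∘_; _⇔_; mk⇔; Equivalence)
open import Level using (Level; 0ℓ)
open import Relation.Binary using (Rel; Symmetric; Transitive; IsPartialEquivalence)
import Relation.Binary.Definitions as B
open import Relation.Binary.PropositionalEquality
open import Relation.Nullary using (¬_; yes; no; contradiction)
open import Relation.Nullary.Decidable using (T?; decidable-stable; _×-dec_; ¬?)
open import Relation.Unary using (Pred; Decidable; _≐_)

T-⇒ : ∀ {a b} → T (not a ∨ b) → T a → T b
T-⇒ {true} b _ = b

T-injective : ∀ {a b} → (T a → T b) → (T b → T a) → a ≡ b
T-injective {false} {false} _ _ = refl
T-injective {false} {true}  _ g = ⊥-elim (g _)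
T-injective {true}  {false} f _ = ⊥-elim (f _)
T-injective {true}  {true}  _ _ = refl

all-T : ∀ {A : Set} (p : A → Bool) {xs x} → T (all p xs) → x ∈ xs → T (p x)
all-T p {xs} h = All.lookup (all⁺ p xs h)

module _ {A : Set} where

  Unique⇒lookup-injective : ∀ {xs : List A} → Unique xs → ∀ i j → lookup xs i ≡ lookup xs j → i ≡ j
  Unique⇒lookup-injective (_ ∷ _)   zero    zero    _  = refl
  Unique⇒lookup-injective (x∉ ∷ _)  zero    (suc j) eq = contradiction eq (All.lookup x∉ (∈-lookup j))
  Unique⇒lookup-injective (x∉ ∷ _)  (suc i) zero    eq = contradiction (sym eq) (All.lookup x∉ (∈-lookup i))
  Unique⇒lookup-injective (_ ∷ xs!) (suc i) (suc j) eq = cong suc (Unique⇒lookup-injective xs! i j eq)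

  Unique⇒length≤ : ∀ {xs : List A} {k} (f : A → Fin k) → Unique xs →
                   (∀ {x y} → x ∈ xs → y ∈ xs → f x ≡ f y → x ≡ y) → length xs ≤ k
  Unique⇒length≤ {xs} f xs! f-inj = ≮⇒≥ λ k<len →
    let i , j , i<j , fi≡fj = pigeonhole k<len (f ∘ lookup xs)
    in <⇒≢ i<j (Unique⇒lookup-injective xs! i j (f-inj (∈-lookup i) (∈-lookup j) fi≡fj))

∈-allSubsets : ∀ {n} (S : Subset n) → S ∈ allSubsets n
∈-allSubsets []                  = here refl
∈-allSubsets {suc n} (false ∷ S) = ∈-++⁺ˡ (∈-map⁺ (false ∷_) (∈-allSubsets S))
∈-allSubsets {suc n} (true ∷ S)  = ∈-++⁺ʳ _ (∈-map⁺ (true ∷_) (∈-allSubsets S))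

allFamilies-unique : ∀ n → Unique (allFamilies n)
allFamilies-unique zero    = ((λ ()) ∷ []) ∷ ([] ∷ [])
allFamilies-unique (suc n) = cartesianProduct⁺ (allFamilies-unique n) (allFamilies-unique n)

mem-ext : ∀ {n} (F G : Family n) → (∀ S → mem F S ≡ mem G S) → F ≡ G
mem-ext {zero}  F G h = h []
mem-ext {suc n} (F₀ , F₁) (G₀ , G₁) h =
  cong₂ _,_ (mem-ext F₀ G₀ (h ∘ (false ∷_))) (mem-ext F₁ G₁ (h ∘ (true ∷_)))

module _ {n : ℕ} where

  pair : Fin n → Fin n → Subset n
  pair i j = ⊥ [ i ]≔ true [ j ]≔ true

  pair-comm : ∀ i j → pair i j ≡ pair j i
  pair-comm i j with i ≟ j
  ... | yes refl = refl
  ... | no i≢j   = []≔-commutes ⊥ i j i≢j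

  lookup-pairʳ : ∀ i j → Vec.lookup (pair i j) j ≡ true
  lookup-pairʳ i j = lookup∘update j (⊥ [ i ]≔ true) true

  lookup-⊥[]≔ : ∀ {i k : Fin n} → k ≢ i → Vec.lookup (⊥ [ i ]≔ true) k ≡ false
  lookup-⊥[]≔ {k = k} k≢i = trans (lookup∘update′ k≢i ⊥ true) (lookup-replicate k false)

  lookup-pair-outside : ∀ {i j k : Fin n} → k ≢ i → k ≢ j → Vec.lookup (pair i j) k ≡ false
  lookup-pair-outside {i} k≢i k≢j = trans (lookup∘update′ k≢j (⊥ [ i ]≔ true) true) (lookup-⊥[]≔ k≢i)

  lookup-pair⁻ : ∀ {i j k : Fin n} → Vec.lookup (pair i j) k ≡ true → k ≡ i ⊎ k ≡ j
  lookup-pair⁻ {i} {j} {k} k∈ij with k ≟ i | k ≟ j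
  ... | yes k≡i | _       = inj₁ k≡i
  ... | no _    | yes k≡j = inj₂ k≡j
  ... | no k≢i  | no k≢j  with () ← trans (sym k∈ij) (lookup-pair-outside k≢i k≢j)

  pair-remove : ∀ {i j : Fin n} → j ≢ i → pair i j [ j ]≔ false ≡ ⊥ [ i ]≔ true
  pair-remove {i} {j} j≢i = begin
    ⊥ [ i ]≔ true [ j ]≔ true [ j ]≔ false                   ≡⟨ []≔-idempotent (⊥ [ i ]≔ true) j ⟩
    ⊥ [ i ]≔ true [ j ]≔ false                              ≡⟨ cong (⊥ [ i ]≔ true [ j ]≔_) (lookup-⊥[]≔ j≢i) ⟨
    ⊥ [ i ]≔ true [ j ]≔ Vec.lookup (⊥ [ i ]≔ true) j       ≡⟨ []≔-lookup (⊥ [ i ]≔ true) j ⟩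
    ⊥ [ i ]≔ true                                           ∎
    where open ≡-Reasoning

∣⊥[i]≔true∣≡1 : ∀ {n} (i : Fin n) → ∣ ⊥ [ i ]≔ true ∣ ≡ 1
∣⊥[i]≔true∣≡1 {suc n} zero = cong suc (∣⊥∣≡0 n)
∣⊥[i]≔true∣≡1 (suc i)      = ∣⊥[i]≔true∣≡1 i

∣pair-i-i∣≡1 : ∀ {n} (i : Fin n) → ∣ pair i i ∣ ≡ 1
∣pair-i-i∣≡1 i = trans (cong ∣_∣ ([]≔-idempotent ⊥ i)) (∣⊥[i]≔true∣≡1 i)

∣p∣≡0⇒p≡⊥ : ∀ {n} (p : Subset n) → ∣ p ∣ ≡ 0 → p ≡ ⊥
∣p∣≡0⇒p≡⊥ []          _ = refl
∣p∣≡0⇒p≡⊥ (false ∷ p) h = cong (false ∷_) (∣p∣≡0⇒p≡⊥ p h)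

∣p∣≡1⇒singleton : ∀ {n} (p : Subset n) → ∣ p ∣ ≡ 1 → ∃ λ i → p ≡ ⊥ [ i ]≔ true
∣p∣≡1⇒singleton (true ∷ p)  h = zero , cong (true ∷_) (∣p∣≡0⇒p≡⊥ p (suc-injective h))
∣p∣≡1⇒singleton (false ∷ p) h = Product.map suc (cong (false ∷_)) (∣p∣≡1⇒singleton p h)

∣p∣≡2⇒pair : ∀ {n} (p : Subset n) → ∣ p ∣ ≡ 2 → ∃₂ λ i j → p ≡ pair i j
∣p∣≡2⇒pair (true ∷ p) h with j , p≡j ← ∣p∣≡1⇒singleton p (suc-injective h) =
  zero , suc j , cong (true ∷_) p≡j
∣p∣≡2⇒pair (false ∷ p) h with i , j , p≡ij ← ∣p∣≡2⇒pair p h =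
  suc i , suc j , cong (false ∷_) p≡ij

first : ∀ {n p} {P : Pred (Fin n) p} → Decidable P → Maybe (Fin n)
first {zero}  P? = nothing
first {suc n} P? with P? zero
... | yes _ = just zero
... | no  _ = Maybe.map suc (first (λ k → P? (suc k)))

module _ {p : Level} where

  first-sound : ∀ {n} {P : Pred (Fin n) p} (P? : Decidable P) {k} → first P? ≡ just k → P k
  first-sound {suc n} P? eq with P? zero
  first-sound {suc n} P? refl | yes Pz = Pz
  first-sound {suc n} P? eq   | no _ with first (λ k → P? (suc k)) in found
  first-sound {suc n} P? refl | no _ | just k = first-sound (λ k → P? (suc k)) found

  first-complete : ∀ {n} {P : Pred (Fin n) p} (P? : Decidable P) {k} → P k → ∃ λ j → first P? ≡ just j
  first-complete {suc n} P? {k} Pk with P? zero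
  ... | yes _ = zero , refl
  ... | no ¬Pz with k
  ...   | zero  = contradiction Pk ¬Pz
  ...   | suc k with j , eq ← first-complete (λ k → P? (suc k)) Pk = suc j , cong (Maybe.map suc) eq

  first-cong : ∀ {n} {P Q : Pred (Fin n) p} (P? : Decidable P) (Q? : Decidable Q) → P ≐ Q → first P? ≡ first Q?
  first-cong {zero}  P? Q? _ = refl
  first-cong {suc n} P? Q? (P⊆Q , Q⊆P) with P? zero | Q? zero
  ... | yes _  | yes _  = refl
  ... | yes Pz | no ¬Qz = contradiction (P⊆Q Pz) ¬Qz
  ... | no ¬Pz | yes Qz = contradiction (Q⊆P Qz) ¬Pz
  ... | no _   | no _   = cong (Maybe.map suc) (first-cong (λ k → P? (suc k)) (λ k → Q? (suc k)) (P⊆Q , Q⊆P))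

module _ {n : ℕ} {r : Level} {R : Rel (Fin n) r} (R? : B.Decidable R) (isPER : IsPartialEquivalence R) where
  open IsPartialEquivalence isPER renaming (sym to R-sym; trans to R-trans)

  related⇒same-first : ∀ {a b} → R a b → ∃ λ k → first (R? a) ≡ just k × first (R? b) ≡ just k
  related⇒same-first {a} {b} Rab with k , ak ← first-complete (R? a) (R-trans Rab (R-sym Rab)) =
    k , ak , trans (first-cong (R? b) (R? a) (R-trans Rab , R-trans (R-sym Rab))) ak

  same-first⇒related : ∀ {a b k} → first (R? a) ≡ just k → first (R? b) ≡ just k → R a b
  same-first⇒related ak bk = R-trans (first-sound (R? _) ak) (R-sym (first-sound (R? _) bk))

module _ {n : ℕ} {r s : Level} {R : Rel (Fin n) r} {R′ : Rel (Fin n) s}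
         (R? : B.Decidable R) (R′? : B.Decidable R′)
         (isPER : IsPartialEquivalence R) (isPER′ : IsPartialEquivalence R′) where

  first-determines-PER : (∀ a → first (R? a) ≡ first (R′? a)) → ∀ {a b} → R a b → R′ a b
  first-determines-PER same {a} {b} Rab with k , ak , bk ← related⇒same-first R? isPER Rab =
    same-first⇒related R′? isPER′ (trans (sym (same a)) ak) (trans (sym (same b)) bk)

module Bases {n : ℕ} (F : Family n) where

  Base : Subset n → Set
  Base B = T (mem F B)

  NonLoop : Fin n → Set
  NonLoop a = ∃ λ b → Base (pair a b)

  infix 4 _∥_ _∥?_

  _∥_ : Rel (Fin n) 0ℓ
  a ∥ b = NonLoop a × NonLoop b × ¬ Base (pair a b)

  nonLoop? : Decidable NonLoop
  nonLoop? a = any? (λ b → T? (mem F (pair a b)))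

  _∥?_ : B.Decidable _∥_
  a ∥? b = nonLoop? a ×-dec nonLoop? b ×-dec ¬? (T? (mem F (pair a b)))

  parallelClass : Fin n → Maybe (Fin n)
  parallelClass a = first (a ∥?_)

  pair-base-comm : ∀ {a b} → Base (pair a b) → Base (pair b a)
  pair-base-comm {a} {b} = subst Base (pair-comm a b)

  ∥-sym : Symmetric _∥_
  ∥-sym (na , nb , ¬ab) = nb , na , ¬ab ∘ pair-base-comm

  module _ (isM : T (isRank2Matroid F)) where

    private
      axioms : T (baseExchange F ∧ all (λ B → not (mem F B) ∨ (∣ B ∣ ≡ᵇ 2)) (allSubsets n))
      axioms = proj₂ (Equivalence.to (T-∧ {any (mem F) (allSubsets n)}) isM)

      exchangeᵇ : T (baseExchange F)
      exchangeᵇ = proj₁ (Equivalence.to (T-∧ {baseExchange F}) axioms)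

      sizeᵇ : T (all (λ B → not (mem F B) ∨ (∣ B ∣ ≡ᵇ 2)) (allSubsets n))
      sizeᵇ = proj₂ (Equivalence.to (T-∧ {baseExchange F}) axioms)

    base-size : ∀ {B} → Base B → ∣ B ∣ ≡ 2
    base-size {B} b = ≡ᵇ⇒≡ _ 2 (T-⇒ (all-T _ sizeᵇ (∈-allSubsets B)) b)

    exchange : ∀ {B B′ e} → Base B → Base B′ → Vec.lookup B e ≡ true → Vec.lookup B′ e ≡ false →
               ∃ λ f → Vec.lookup B′ f ≡ true × Base (B [ e ]≔ false [ f ]≔ true)
    exchange {B} {B′} {e} b b′ e∈B e∉B′ =
      let forB        = T-⇒ (all-T _ exchangeᵇ (∈-allSubsets B)) b
          forB′       = T-⇒ (all-T _ forB (∈-allSubsets B′)) b′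
          f , f-ok    = satisfied (any⁻ swapsIn (allFin n) (T-⇒ (all-T _ forB′ (∈-allFin e)) e∈B∖B′))
          f∈B′ , rest = Equivalence.to (T-∧ {Vec.lookup B′ f}) f-ok
      in f , Equivalence.to T-≡ f∈B′ , proj₂ (Equivalence.to (T-∧ {not (Vec.lookup B f)}) rest)
      where
      swapsIn : Fin n → Bool
      swapsIn f = Vec.lookup B′ f ∧ not (Vec.lookup B f) ∧ mem F (B [ e ]≔ false [ f ]≔ true)
      e∈B∖B′ : T (Vec.lookup B e ∧ not (Vec.lookup B′ e))
      e∈B∖B′ rewrite e∈B | e∉B′ = _

    pair-self-not-base : ∀ {a} → ¬ Base (pair a a)
    pair-self-not-base {a} aa with () ← trans (sym (∣pair-i-i∣≡1 a)) (base-size aa)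

    base-is-pair : ∀ {B} → Base B → ∃₂ λ a b → B ≡ pair a b
    base-is-pair {B} b = ∣p∣≡2⇒pair B (base-size b)

    pair-exchange : ∀ {x y z l} → l ≢ x → l ≢ y → Base (pair z l) → Base (pair x y) →
                    ∃ λ f → (f ≡ x ⊎ f ≡ y) × Base (pair z f)
    pair-exchange {x} {y} {z} {l} l≢x l≢y zl xy =
      let f , f∈xy , zlf = exchange zl xy (lookup-pairʳ z l) (lookup-pair-outside l≢x l≢y)
      in f , lookup-pair⁻ {i = x} f∈xy , subst (λ S → Base (S [ f ]≔ true)) (pair-remove l≢z) zlf
      where
      l≢z : l ≢ z
      l≢z refl = pair-self-not-base zl

    pair-not-base-trans : ∀ {x y z} → NonLoop z → ¬ Base (pair x z) → ¬ Base (pair z y) → ¬ Base (pair x y)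
    pair-not-base-trans {x} {y} {z} (l , zl) ¬xz ¬zy xy with l ≟ x | l ≟ y
    ... | yes refl | _        = ¬xz (pair-base-comm zl)
    ... | no _     | yes refl = ¬zy zl
    ... | no l≢x   | no l≢y   with pair-exchange l≢x l≢y zl xy
    ...   | _ , inj₁ refl , zf = ¬xz (pair-base-comm zf)
    ...   | _ , inj₂ refl , zf = ¬zy zf

    ∥-trans : Transitive _∥_
    ∥-trans (nx , nz , ¬xz) (_ , ny , ¬zy) = nx , ny , pair-not-base-trans nz ¬xz ¬zy

    ∥-isPartialEquivalence : IsPartialEquivalence _∥_
    ∥-isPartialEquivalence = record { sym = ∥-sym ; trans = ∥-trans }

    nonLoop⇒∥-refl : ∀ {a} → NonLoop a → a ∥ a
    nonLoop⇒∥-refl na = na , na , pair-self-not-base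

    pair-base⇔ : ∀ {a b} → Base (pair a b) ⇔ (a ∥ a × b ∥ b × ¬ a ∥ b)
    pair-base⇔ {a} {b} = mk⇔
      (λ ab → nonLoop⇒∥-refl (b , ab) , nonLoop⇒∥-refl (a , pair-base-comm ab) , λ a∥b → proj₂ (proj₂ a∥b) ab)
      (λ (aa , bb , a∦b) → decidable-stable (T? _) (λ ¬ab → a∦b (proj₁ aa , proj₁ bb , ¬ab)))

module _ {n : ℕ} {F G : Family n} (isF : T (isRank2Matroid F)) (isG : T (isRank2Matroid G))
         (same : ∀ a → Bases.parallelClass F a ≡ Bases.parallelClass G a) where

  private
    module F = Bases F
    module G = Bases G

  base-transfer : ∀ {S} → F.Base S → G.Base S
  base-transfer {S} FS with a , b , refl ← F.base-is-pair isF FS =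
    let aa , bb , a∦b = Equivalence.to (F.pair-base⇔ isF) FS
    in Equivalence.from (G.pair-base⇔ isG) (F⇒G aa , F⇒G bb , a∦b ∘ G⇒F)
    where
    F⇒G : ∀ {a b} → a F.∥ b → a G.∥ b
    F⇒G = first-determines-PER F._∥?_ G._∥?_ (F.∥-isPartialEquivalence isF) (G.∥-isPartialEquivalence isG) same
    G⇒F : ∀ {a b} → a G.∥ b → a F.∥ b
    G⇒F = first-determines-PER G._∥?_ F._∥?_ (G.∥-isPartialEquivalence isG) (F.∥-isPartialEquivalence isF) (sym ∘ same)

parallelClass-injective : ∀ {n} {F G : Family n} → T (isRank2Matroid F) → T (isRank2Matroid G) →
                          (∀ a → Bases.parallelClass F a ≡ Bases.parallelClass G a) → F ≡ G
parallelClass-injective {F = F} {G} isF isG same = mem-ext F G λ S →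
  T-injective (base-transfer isF isG same) (base-transfer isG isF (sym ∘ same))

maybeFin : ∀ {n} → Maybe (Fin n) → Fin (suc n)
maybeFin = maybe suc zero

maybeFin-injective : ∀ {n} {u v : Maybe (Fin n)} → maybeFin u ≡ maybeFin v → u ≡ v
maybeFin-injective {u = nothing} {nothing} _    = refl
maybeFin-injective {u = just _}  {just _}  refl = refl

encode : ∀ {n} → Family n → Fin (suc n ^ n)
encode F = funToFin (maybeFin ∘ Bases.parallelClass F)

encode-injective : ∀ {n} {F G : Family n} → T (isRank2Matroid F) → T (isRank2Matroid G) → encode F ≡ encode G → F ≡ G
encode-injective {F = F} {G} isF isG eq = parallelClass-injective isF isG λ a → maybeFin-injective (begin
  maybeFin (Bases.parallelClass F a) ≡⟨ finToFun-funToFin (maybeFin ∘ Bases.parallelClass F) a ⟨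
  finToFun (encode F) a              ≡⟨ cong (λ k → finToFun k a) eq ⟩
  finToFun (encode G) a              ≡⟨ finToFun-funToFin (maybeFin ∘ Bases.parallelClass G) a ⟩
  maybeFin (Bases.parallelClass G a) ∎)
  where open ≡-Reasoning

m₂≤[1+n]^n : ∀ n → m₂ n ≤ suc n ^ n
m₂≤[1+n]^n n = Unique⇒length≤ encode (filter⁺ isM? (allFamilies-unique n))
  λ F∈ G∈ → encode-injective (isMatroid F∈) (isMatroid G∈)
  where
  isM? : Decidable (T ∘ isRank2Matroid {n})
  isM? = T? ∘ isRank2Matroid
  isMatroid : ∀ {F} → F ∈ filter isM? (allFamilies n) → T (isRank2Matroid F)
  isMatroid = proj₂ ∘ ∈-filter⁻ isM? {xs = allFamilies n}

lemma4 : (n : ℕ) → m₂ n + 1 ≤ suc n ^ suc n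
-- m₂ 0 evaluates to 0: no subset of the empty ground set has two elements.
lemma4 zero    = s≤s z≤n
lemma4 (suc n) = begin
  m₂ (suc n) + 1 ≤⟨ +-monoˡ-≤ 1 (m₂≤[1+n]^n (suc n)) ⟩
  q + 1          ≤⟨ +-monoʳ-≤ q (≤-trans (m^n>0 (suc (suc n)) (suc n)) (m≤n*m q (suc n))) ⟩
  q + suc n * q  ∎
  where
  open ≤-Reasoning
  q = suc (suc n) ^ suc n
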